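{- Let $n\ge1$ and $d\ge1$ be integers, and let $$E(d,n)=\{\mathrm{inc}(\pi): \pi\in S_n,\ \exists\, k\in\{0,\dots,n-1\}\ \forall i\in\mathbb{Z}/n\mathbb{Z},\ \pi(i+d)\equiv\pi(i)+k \pmod n\}.$$ Then $$E(d,n)=\bigcup_{k\mid d}\ \bigcup_{C\in\mathrm{cycles}^{(1)}(k)} C,$$ and consequently $$\bigl|\mathrm{cycles}^{(1)}(d)\bigr|=\frac1d\Bigl(|E(d,n)|-\sum_{k\mid d,\,k\neq d}k\,\bigl|\mathrm{cycles}^{(1)}(k)\bigr|\Bigr).$$
   Context: Let $\sigma\in S_n$ be $\sigma(i)=i+1$ for $i<n$, $\sigma(n)=1$; positions and values of permutations are taken modulo $n$ with representatives in $\{1,\dots,n\}$. For $\pi\in S_n$ let $\mathrm{inc}(\pi)=\{\sigma^j\circ\pi:0\le j\le n-1\}$; these sets are the classes of an equivalence relation on $S_n$. The map $f(\mathrm{inc}(\pi))=\mathrm{inc}(\pi\circ\sigma)$ is a well-defined permutation of the set of classes. A 1-cycle is an orbit of $f$, viewed as a set of classes (a class fixed by $f$ is a 1-cycle of length 1); $\mathrm{cycles}^{(1)}(k)$ is the set of 1-cycles consisting of exactly $k$ classes. -}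

module Defs where

open import Data.Nat using (ℕ; zero; suc; _+_; _*_; _<_; NonZero)
open import Data.Nat.DivMod using (_mod_)
open import Data.Nat.Divisibility using (_∣?_)
open import Data.Fin using (Fin; toℕ)
open import Data.List using (List; map; filter; upTo)
open import Data.Nat.ListAction using (sum)
open import Data.Product using (Σ; ∃; ∃-syntax; _×_)
open import Relation.Nullary using (¬_)
open import Relation.Binary.PropositionalEquality using (_≡_; _≢_)
open import Function using (_∘_)
open import Function.Bundles using (_⇔_)
open import Function.Definitions using (Bijective)

-- Positions/values are Fin n = {0,…,n-1} (representatives of ℤ/nℤ;
-- the paper's {1,…,n} is the same cyclic group shifted by one).

Fun : ℕ → Set
Fun n = Fin n → Fin n

IsPerm : (n : ℕ) → Fun n → Set
IsPerm n π = Bijective _≡_ _≡_ π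

iter : {A : Set} → ℕ → (A → A) → A → A
iter zero    g x = x
iter (suc j) g x = g (iter j g x)

module _ (n : ℕ) .{{_ : NonZero n}} where

  σ : Fun n
  σ i = suc (toℕ i) mod n

  -- τ ∈ inc(π) : τ = σ^j ∘ π for some 0 ≤ j ≤ n-1
  InInc : Fun n → Fun n → Set
  InInc π τ = ∃[ j ] (j < n × (∀ x → τ x ≡ iter j σ (π x)))

  -- inc(π) = inc(π')  (written via membership of the representative π')
  SameClass : Fun n → Fun n → Set
  SameClass π π' = InInc π π'

  -- inc(π) lies in the f-orbit of inc(ρ), where f(inc(ρ)) = inc(ρ ∘ σ):
  -- inc(π) = f^j(inc ρ) = inc(ρ ∘ σ^j) for some j ∈ ℕ
  InOrbit : Fun n → Fun n → Set
  InOrbit ρ π = ∃[ j ] SameClass (ρ ∘ iter j σ) π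

  -- the 1-cycle (orbit of f) containing inc(ρ) consists of exactly k classes:
  -- there are k pairwise distinct classes in it which exhaust it
  OrbitSize : Fun n → ℕ → Set
  OrbitSize ρ k =
    Σ (Fin k → Fun n) λ τ → ((∀ (i : Fin k) → IsPerm n (τ i) × InOrbit ρ (τ i))
          × (∀ (i j : Fin k) → i ≢ j → ¬ SameClass (τ i) (τ j))
          × (∀ π → IsPerm n π → InOrbit ρ π → ∃[ i ] SameClass (τ i) π))

  EProp : ℕ → Fun n → Set
  EProp d π = ∃[ k ] (k < n ×
    (∀ (i : Fin n) → π ((toℕ i + d) mod n) ≡ (toℕ (π i) + k) mod n))

  InE : ℕ → Fun n → Set
  InE d π' = ∃[ π ] (IsPerm n π × EProp d π × SameClass π π')

  CardE : ℕ → ℕ → Set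
  CardE d e =
    Σ (Fin e → Fun n) λ τ → ((∀ (i : Fin e) → IsPerm n (τ i) × InE d (τ i))
          × (∀ (i j : Fin e) → i ≢ j → ¬ SameClass (τ i) (τ j))
          × (∀ π → IsPerm n π → InE d π → ∃[ i ] SameClass (τ i) π))

  SameCycle : Fun n → Fun n → Set
  SameCycle ρ ρ' = ∀ π → IsPerm n π → (InOrbit ρ π ⇔ InOrbit ρ' π)

  -- |cycles⁽¹⁾(k)| = c : c pairwise distinct 1-cycles with k classes,
  -- exhausting all 1-cycles with k classes (each given by a representative)
  NumCycles : ℕ → ℕ → Set
  NumCycles k c =
    Σ (Fin c → Fun n) λ τ → ((∀ (i : Fin c) → IsPerm n (τ i) × OrbitSize (τ i) k)
          × (∀ (i j : Fin c) → i ≢ j → ¬ SameCycle (τ i) (τ j))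
          × (∀ ρ → IsPerm n ρ → OrbitSize ρ k → ∃[ i ] SameCycle (τ i) ρ))

-- Σ_{k ∣ d, k ≠ d} k · c(k)   (for d ≥ 1 these are the divisors in [0, d))
properDivSum : ℕ → (ℕ → ℕ) → ℕ
properDivSum d c = sum (map (λ k → k * c k) (filter (_∣? d) (upTo d)))

-- The classes inc(π) carry the ℕ-action j · inc(π) = inc(π ∘ σʲ), which has finite order n;
-- the 1-cycle through a class is its orbit, and its size is the least period p of the
-- class. The condition defining E(d,n) says π ∘ σᵈ = σᵏ ∘ π, i.e. that σᵈ fixes inc(π),
-- which happens exactly when p ∣ d. Hence E(d,n) is the disjoint union of the 1-cycles
-- of size dividing d, so |E(d,n)| = Σ_{k ∣ d} k·|cycles⁽¹⁾(k)|, and solving for the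
-- term k = d gives the formula.

module Submission where

open import Defs

open import Level using (Level; 0ℓ)
open import Data.Empty using (⊥-elim)
open import Data.Fin using (Fin; zero; suc; toℕ; fromℕ<; splitAt; join)
open import Data.Fin.Properties
  using (injective⇒≤; splitAt-join; join-splitAt; suc-injective; 0≢1+n; toℕ-injective; any?; all?; toℕ-fromℕ<; toℕ<n)
  renaming (_≟_ to _≟ᶠ_)
open import Data.List using ([]; _∷_; _++_; map; filter; upTo)
open import Data.List.Properties using (upTo-∷ʳ; filter-++; map-++)
open import Data.Nat using (ℕ; zero; suc; _+_; _*_; _∸_; _%_; _<_; _≤_; z≤n; s≤s; NonZero; >-nonZero)
  renaming (_/_ to _/ℕ_)
open import Data.Nat.DivMod using (_mod_; m≡m%n+[m/n]*n; m%n<n; %-distribˡ-+; m%n%n≡m%n; m*n%n≡0; m<n⇒m%n≡m; n%n≡0)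
open import Data.Nat.Divisibility using (_∣_; _∣?_; divides; m%n≡0⇒n∣m; ∣⇒≤; ∣-refl)
open import Data.Nat.ListAction using (sum)
open import Data.Nat.ListAction.Properties using (sum-++)
open import Data.Nat.Properties
  using (<-cmp; +-comm; +-identityʳ; *-suc; m<1+n⇒m<n∨m≡n; n<1+n; m<n⇒m<1+n; m+[n∸m]≡n; m<n⇒0<n∸m; <-irrefl; +-suc;
         ≤-antisym; n≢0⇒n>0; *-comm; m≤m+n; m+n∸m≡n; m∸n≤m; ≤-<-trans; <⇒≤; _<?_)
  renaming (_≟_ to _≟ℕ_)
open import Data.Product using (Σ; ∃; ∃-syntax; _×_; _,_; proj₁; proj₂)
open import Data.Integer using (+_; _-_)
open import Data.Integer.Properties using (pos-*; [+m]-[+n]≡m⊖n; ⊖-≥)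
import Data.Integer as ℤ
import Data.Integer.Properties as ℤ
open import Data.Rational using (_/_)
open import Data.Rational.Properties using (fromℚᵘ-cong)
open import Data.Rational.Unnormalised using (mkℚᵘ; *≡*)
open import Data.Sum using (_⊎_; inj₁; inj₂; [_,_]; [_,_]′; map₂; fromInj₁)
open import Function using (_∘_)
open import Function.Bundles using (_⇔_; mk⇔; Equivalence; Bijection; mk↔ₛ′)
open import Function.Definitions using (Bijective)
open import Function.Properties.Inverse using (Inverse⇒Bijection)
open import Function.Construct.Composition using (bijective)
open import Relation.Binary using (Setoid; IsEquivalence; Decidable; tri<; tri≈; tri>)
open import Relation.Binary.PropositionalEquality using (_≡_; _≢_; _≗_; refl; cong; subst; module ≡-Reasoning)
  renaming (sym to ≡-sym; trans to ≡-trans)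
open import Relation.Nullary using (¬_; yes; no)
open import Relation.Nullary.Decidable using (decidable-stable; _×-dec_; map′)
open import Relation.Unary using (Pred; _∪_) renaming (Decidable to Decidableᵘ)

Least : ∀ {q} → Pred ℕ q → Pred ℕ q
Least Q p = Q p × (∀ m → m < p → ¬ Q m)

least-unique : ∀ {q} {Q : Pred ℕ q} {p p′} → Least Q p → Least Q p′ → p ≡ p′
least-unique {p = p} {p′} (Qp , below) (Qp′ , below′) with <-cmp p p′
... | tri< p<p′ _ _ = ⊥-elim (below′ p p<p′ Qp)
... | tri≈ _ p≡p′ _ = p≡p′
... | tri> _ _ p′<p = ⊥-elim (below p′ p′<p Qp′)

module _ {q} {Q : Pred ℕ q} (Q? : Decidableᵘ Q) where

  least-below : ∀ N → ∃ (Least Q) ⊎ (∀ m → m < N → ¬ Q m)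
  least-below zero = inj₂ λ _ ()
  least-below (suc N) with least-below N | Q? N
  ... | inj₁ found | _ = inj₁ found
  ... | inj₂ none | yes QN = inj₁ (N , QN , none)
  ... | inj₂ none | no ¬QN = inj₂ λ m m<1+N → [ none m , (λ { refl → ¬QN }) ]′ (m<1+n⇒m<n∨m≡n m<1+N)

  least-exists : ∀ {N} → Q N → ∃ (Least Q)
  least-exists {N} QN = fromInj₁ (λ none → ⊥-elim (none N (n<1+n N) QN)) (least-below (suc N))

sum-filter-upTo-suc : ∀ {q} {D : Pred ℕ q} (D? : Decidableᵘ D) (g : ℕ → ℕ) m →
                      sum (map g (filter D? (upTo (suc m)))) ≡
                      sum (map g (filter D? (upTo m))) + sum (map g (filter D? (m ∷ [])))
sum-filter-upTo-suc D? g m = begin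
  sum (map g (filter D? (upTo (suc m))))                      ≡⟨ cong (sum ∘ map g ∘ filter D?) (≡-sym (upTo-∷ʳ m)) ⟩
  sum (map g (filter D? (upTo m ++ m ∷ [])))                  ≡⟨ cong (sum ∘ map g) (filter-++ D? (upTo m) (m ∷ [])) ⟩
  sum (map g (filter D? (upTo m) ++ filter D? (m ∷ [])))      ≡⟨ cong sum (map-++ g (filter D? (upTo m)) _) ⟩
  sum (map g (filter D? (upTo m)) ++ map g (filter D? (m ∷ []))) ≡⟨ sum-++ (map g (filter D? (upTo m))) _ ⟩
  sum (map g (filter D? (upTo m))) + sum (map g (filter D? (m ∷ []))) ∎
  where open ≡-Reasoning

sum-filter-singleton : ∀ {q} {D : Pred ℕ q} (D? : Decidableᵘ D) (g : ℕ → ℕ) {m} → D m →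
                       sum (map g (filter D? (m ∷ []))) ≡ g m
sum-filter-singleton D? g {m} Dm with D? m
... | yes _ = +-identityʳ (g m)
... | no ¬Dm = ⊥-elim (¬Dm Dm)

+[m+n]-+m≡+n : ∀ m n → (+ (m + n)) - (+ m) ≡ + n
+[m+n]-+m≡+n m n = ≡-trans ([+m]-[+n]≡m⊖n (m + n) m) (≡-trans (⊖-≥ (m≤m+n m n)) (cong +_ (m+n∸m≡n m n)))

e≡s+n*m⇒m/1≡[e-s]/n : ∀ {m n s e} .{{_ : NonZero n}} → e ≡ s + n * m → (+ m) / 1 ≡ ((+ e) - (+ s)) / n
e≡s+n*m⇒m/1≡[e-s]/n {m} {n@(suc n-1)} {s} refl = begin
  (+ m) / 1                     ≡⟨ fromℚᵘ-cong {mkℚᵘ (+ m) 0} {mkℚᵘ (+ (n * m)) n-1} (*≡* m*n≡n*m*1) ⟩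
  (+ (n * m)) / n               ≡⟨ cong (_/ n) (+[m+n]-+m≡+n s (n * m)) ⟨
  ((+ (s + n * m)) - (+ s)) / n ∎
  where
  open ≡-Reasoning
  m*n≡n*m*1 : (+ m) ℤ.* (+ n) ≡ (+ (n * m)) ℤ.* (+ 1)
  m*n≡n*m*1 = ≡-trans (≡-sym (pos-* m n)) (≡-trans (cong +_ (*-comm m n)) (≡-sym (ℤ.*-identityʳ (+ (n * m)))))

≗-bijective : ∀ {a} {A : Set a} {f g : A → A} → f ≗ g → Bijective _≡_ _≡_ f → Bijective _≡_ _≡_ g
≗-bijective f≗g (injective , surjective) =
  (λ gx≡gy → injective (≡-trans (f≗g _) (≡-trans gx≡gy (≡-sym (f≗g _))))) ,
  λ y → let x , onto = surjective y in x , λ z≡x → ≡-trans (≡-sym (f≗g _)) (onto z≡x)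

module Counting {c ℓ} (S : Setoid c ℓ) where
  open Setoid S

  private variable
    p : Level
    a b k m : ℕ
    P Q : Pred Carrier p

  Distinct : (Fin m → Carrier) → Set ℓ
  Distinct τ = ∀ i j → i ≢ j → ¬ τ i ≈ τ j

  -- P meets exactly m classes of ≈: the shape of OrbitSize, CardE and NumCycles
  Count : Pred Carrier p → ℕ → Set _
  Count P m = Σ (Fin m → Carrier) λ τ → (∀ i → P (τ i)) × Distinct τ × (∀ x → P x → ∃ λ i → τ i ≈ x)

  count-≤ : Count P a → Count P b → a ≤ b
  count-≤ (τ , mem , distinct , _) (τ′ , _ , _ , cover) = injective⇒≤ injective
    where
    index : ∀ i → ∃ λ j → τ′ j ≈ τ i
    index i = cover (τ i) (mem i)
    injective : ∀ {i j} → proj₁ (index i) ≡ proj₁ (index j) → i ≡ j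
    injective {i} {j} same = decidable-stable (i ≟ᶠ j) λ i≢j → distinct i j i≢j
      (trans (sym (proj₂ (index i))) (subst (λ t → τ′ t ≈ τ j) (≡-sym same) (proj₂ (index j))))

  count-unique : Count P a → Count P b → a ≡ b
  count-unique Cᵃ Cᵇ = ≤-antisym (count-≤ Cᵃ Cᵇ) (count-≤ Cᵇ Cᵃ)

  count-⇔ : (∀ x → P x ⇔ Q x) → Count P m → Count Q m
  count-⇔ P⇔Q (τ , mem , distinct , cover) =
    τ , (λ i → Equivalence.to (P⇔Q (τ i)) (mem i)) , distinct , λ x → cover x ∘ Equivalence.from (P⇔Q x)

  count-∅ : (∀ x → ¬ P x) → Count P 0
  count-∅ ¬P = (λ ()) , (λ ()) , (λ ()) , λ x Px → ⊥-elim (¬P x Px)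

  count-⊎ : Count P a → Count Q b → (∀ {x y} → P x → Q y → ¬ x ≈ y) → Count (P ∪ Q) (a + b)
  count-⊎ {P = P} {a} {Q = Q} {b} (τ₁ , mem₁ , distinct₁ , cover₁) (τ₂ , mem₂ , distinct₂ , cover₂) apart =
    τ ∘ splitAt a , mem ∘ splitAt a , distinct , cover
    where
    τ : Fin a ⊎ Fin b → Carrier
    τ = [ τ₁ , τ₂ ]′
    mem : ∀ s → (P ∪ Q) (τ s)
    mem = [ inj₁ ∘ mem₁ , inj₂ ∘ mem₂ ]
    distinct⊎ : ∀ s t → s ≢ t → ¬ τ s ≈ τ t
    distinct⊎ (inj₁ i) (inj₁ j) s≢t = distinct₁ i j (s≢t ∘ cong inj₁)
    distinct⊎ (inj₁ i) (inj₂ j) _ = apart (mem₁ i) (mem₂ j)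
    distinct⊎ (inj₂ i) (inj₁ j) _ = apart (mem₁ j) (mem₂ i) ∘ sym
    distinct⊎ (inj₂ i) (inj₂ j) s≢t = distinct₂ i j (s≢t ∘ cong inj₂)
    distinct : Distinct (τ ∘ splitAt a)
    distinct i j i≢j = distinct⊎ (splitAt a i) (splitAt a j) λ same →
      i≢j (≡-trans (≡-sym (join-splitAt a b i)) (≡-trans (cong (join a b) same) (join-splitAt a b j)))
    cover⊎ : ∀ x → (P ∪ Q) x → ∃ λ s → τ s ≈ x
    cover⊎ x (inj₁ Px) = let i , e = cover₁ x Px in inj₁ i , e
    cover⊎ x (inj₂ Qx) = let i , e = cover₂ x Qx in inj₂ i , e
    cover : ∀ x → (P ∪ Q) x → ∃ λ i → τ (splitAt a i) ≈ x
    cover x PQx = let s , e = cover⊎ x PQx in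
      join a b s , subst (λ t → τ t ≈ x) (≡-sym (splitAt-join a b s)) e

  Disjoint : ∀ {i} {I : Set i} → (I → Pred Carrier p) → Set _
  Disjoint P = ∀ {i j x y} → P i x → P j y → x ≈ y → i ≡ j

  count-⋃ : {P : Fin m → Pred Carrier p} → (∀ i → Count (P i) k) → Disjoint P →
            Count (λ x → ∃ λ i → P i x) (m * k)
  count-⋃ {zero} _ _ = count-∅ λ { x (() , _) }
  count-⋃ {suc m} {P = P} counts disjoint = count-⇔ split (count-⊎ (counts zero) rest apart)
    where
    rest : Count (λ y → ∃ λ i → P (suc i) y) (m * _)
    rest = count-⋃ (counts ∘ suc) λ Px Py x≈y → suc-injective (disjoint Px Py x≈y)
    apart : ∀ {x y} → P zero x → ∃ (λ i → P (suc i) y) → ¬ x ≈ y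
    apart Px (i , Py) x≈y = 0≢1+n (disjoint Px Py x≈y)
    split : ∀ x → (P zero ∪ (λ y → ∃ λ i → P (suc i) y)) x ⇔ (∃ λ i → P i x)
    split x = mk⇔ [ (zero ,_) , (λ (i , Px) → suc i , Px) ]′
                  λ { (zero , Px) → inj₁ Px ; (suc i , Px) → inj₂ (i , Px) }

  count-⋃-upTo : ∀ {q} {D : Pred ℕ q} (D? : Decidableᵘ D) {Q : ℕ → Pred Carrier p} {g : ℕ → ℕ} →
                 (∀ k → D k → Count (Q k) (g k)) → Disjoint Q →
                 ∀ m → Count (λ x → ∃ λ k → k < m × D k × Q k x) (sum (map g (filter D? (upTo m))))
  count-⋃-upTo D? counts disjoint zero = count-∅ λ { x (_ , () , _) }
  count-⋃-upTo {D = D} D? {Q} {g} counts disjoint (suc m) =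
    subst (Count _) (≡-sym (sum-filter-upTo-suc D? g m)) extend
    where
    Below : ℕ → Pred Carrier _
    Below l x = ∃ λ k → k < l × D k × Q k x
    Sₘ : ℕ
    Sₘ = sum (map g (filter D? (upTo m)))
    below : Count (Below m) Sₘ
    below = count-⋃-upTo D? counts disjoint m
    widen : ∀ {x} → Below m x → Below (suc m) x
    widen (k , k<m , Dk , Qkx) = k , m<n⇒m<1+n k<m , Dk , Qkx
    apart : ∀ {x y} → Below m x → Q m y → ¬ x ≈ y
    apart (k , k<m , _ , Qkx) Qmy x≈y = <-irrefl (disjoint Qkx Qmy x≈y) k<m
    narrow : ∀ {x} → Below (suc m) x → Below m x ⊎ (D m × Q m x)
    narrow (k , k<1+m , Dk , Qkx) with m<1+n⇒m<n∨m≡n k<1+m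
    ... | inj₁ k<m = inj₁ (k , k<m , Dk , Qkx)
    ... | inj₂ refl = inj₂ (Dk , Qkx)
    extend : Count (Below (suc m)) (Sₘ + sum (map g (filter D? (m ∷ []))))
    extend with D? m
    ... | yes Dm = subst (Count (Below (suc m))) (cong (λ t → Sₘ + t) (≡-sym (+-identityʳ (g m))))
      (count-⇔ (λ x → mk⇔ [ widen , (λ Qmx → m , n<1+n m , Dm , Qmx) ]′ (map₂ proj₂ ∘ narrow))
               (count-⊎ below (counts m Dm) apart))
    ... | no ¬Dm = subst (Count (Below (suc m))) (≡-sym (+-identityʳ Sₘ))
      (count-⇔ (λ x → mk⇔ widen ([ (λ below → below) , (λ (Dm , _) → ⊥-elim (¬Dm Dm)) ]′ ∘ narrow)) below)

module FiniteOrderAction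
  {c ℓ} (S : Setoid c ℓ)
  (_≈?_ : Decidable (Setoid._≈_ S))
  (act : ℕ → Setoid.Carrier S → Setoid.Carrier S)
  (act-cong : ∀ m {x y} → Setoid._≈_ S x y → Setoid._≈_ S (act m x) (act m y))
  (act-0 : ∀ x → Setoid._≈_ S (act 0 x) x)
  (act-+ : ∀ a b x → Setoid._≈_ S (act (a + b) x) (act b (act a x)))
  (N-1 : ℕ) (act-N : ∀ x → Setoid._≈_ S (act (suc N-1) x) x)
  where

  open Setoid S using (Carrier; _≈_; sym; trans) renaming (refl to ≈-refl)
  open Counting S
  open import Relation.Binary.Reasoning.Setoid S

  private variable
    x y z : Carrier
    a b j k m : ℕ

  Orbit : Carrier → Pred Carrier ℓ
  Orbit x y = ∃ λ j → act j x ≈ y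

  Fixes : Carrier → Pred ℕ ℓ
  Fixes x m = act m x ≈ x

  Period : Carrier → Pred ℕ ℓ
  Period x = Least (λ m → 0 < m × Fixes x m)

  act-comm : ∀ a b x → act a (act b x) ≈ act b (act a x)
  act-comm a b x = begin
    act a (act b x) ≈⟨ act-+ b a x ⟨
    act (b + a) x   ≡⟨ cong (λ t → act t x) (+-comm b a) ⟩
    act (a + b) x   ≈⟨ act-+ a b x ⟩
    act b (act a x) ∎

  fixes-* : ∀ q → Fixes x k → Fixes x (q * k)
  fixes-* zero _ = act-0 _
  fixes-* {x} {k} (suc q) fixes = begin
    act (k + q * k) x     ≈⟨ act-+ k (q * k) x ⟩
    act (q * k) (act k x) ≈⟨ act-cong (q * k) fixes ⟩
    act (q * k) x         ≈⟨ fixes-* q fixes ⟩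
    x                     ∎

  act-inverse : ∀ m x → act (m * N-1) (act m x) ≈ x
  act-inverse m x = begin
    act (m * N-1) (act m x) ≈⟨ act-+ m (m * N-1) x ⟨
    act (m + m * N-1) x     ≡⟨ cong (λ t → act t x) (≡-sym (*-suc m N-1)) ⟩
    act (m * suc N-1) x     ≈⟨ fixes-* m (act-N x) ⟩
    x                       ∎

  act-cancel : act m x ≈ act m y → x ≈ y
  act-cancel {m} {x} {y} eq = begin
    x                       ≈⟨ act-inverse m x ⟨
    act (m * N-1) (act m x) ≈⟨ act-cong (m * N-1) eq ⟩
    act (m * N-1) (act m y) ≈⟨ act-inverse m y ⟩
    y                       ∎

  orbit-refl : Orbit x x
  orbit-refl {x} = 0 , act-0 x

  ≈⇒orbit : x ≈ y → Orbit x y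
  ≈⇒orbit {x} x≈y = 0 , trans (act-0 x) x≈y

  orbit-sym : Orbit x y → Orbit y x
  orbit-sym {x} (j , e) = j * N-1 , trans (act-cong (j * N-1) (sym e)) (act-inverse j x)

  orbit-trans : Orbit x y → Orbit y z → Orbit x z
  orbit-trans {x} (i , e) (j , f) = i + j , trans (act-+ i j x) (trans (act-cong j e) f)

  fixes-orbit : Orbit x y → Fixes x m → Fixes y m
  fixes-orbit {x} {y} {m} (j , e) fixes = begin
    act m y         ≈⟨ act-cong m e ⟨
    act m (act j x) ≈⟨ act-comm m j x ⟩
    act j (act m x) ≈⟨ act-cong j fixes ⟩
    act j x         ≈⟨ e ⟩
    y               ∎

  act-% : .{{_ : NonZero k}} → Fixes x k → ∀ j → act j x ≈ act (j % k) x
  act-% {k} {x} fixes j = begin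
    act j x                             ≡⟨ cong (λ t → act t x) (≡-trans (m≡m%n+[m/n]*n j k) (+-comm (j % k) _)) ⟩
    act ((j /ℕ k) * k + j % k) x        ≈⟨ act-+ ((j /ℕ k) * k) (j % k) x ⟩
    act (j % k) (act ((j /ℕ k) * k) x)  ≈⟨ act-cong (j % k) (fixes-* (j /ℕ k) fixes) ⟩
    act (j % k) x                       ∎

  fixes-∸ : a ≤ b → act a x ≈ act b x → Fixes x (b ∸ a)
  fixes-∸ {a} {b} {x} a≤b eq = sym (act-cancel (begin
    act a x                 ≈⟨ eq ⟩
    act b x                 ≡⟨ cong (λ t → act t x) (≡-sym (m+[n∸m]≡n a≤b)) ⟩
    act (a + (b ∸ a)) x     ≈⟨ act-+ a (b ∸ a) x ⟩
    act (b ∸ a) (act a x)   ≈⟨ act-comm (b ∸ a) a x ⟩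
    act a (act (b ∸ a) x)   ∎))

  period-exists : ∀ x → ∃ (Period x)
  period-exists x = least-exists (λ m → (0 <? m) ×-dec (act m x ≈? x)) (s≤s z≤n , act-N x)

  period-unique : Period x j → Period x k → j ≡ k
  period-unique = least-unique

  period-orbit : Orbit x y → Period x k → Period y k
  period-orbit o ((0<k , fixes) , below) =
    (0<k , fixes-orbit o fixes) , λ m m<k (0<m , fixes′) → below m m<k (0<m , fixes-orbit (orbit-sym o) fixes′)

  period∣⇔fixes : Period x k → k ∣ m ⇔ Fixes x m
  period∣⇔fixes {x} {k} {m} ((0<k , fixes) , below) = mk⇔ (λ { (divides q refl) → fixes-* q fixes }) divides-m
    where
    instance
      _ : NonZero k
      _ = >-nonZero 0<k
    divides-m : Fixes x m → k ∣ m
    divides-m fixes-m = m%n≡0⇒n∣m m k (decidable-stable (m % k ≟ℕ 0) λ r≢0 →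
      below (m % k) (m%n<n m k) (n≢0⇒n>0 r≢0 , trans (sym (act-% fixes m)) fixes-m))

  fixes⇔period∣ : Fixes x m ⇔ (∃ λ k → k ∣ m × Period x k)
  fixes⇔period∣ {x} = mk⇔
    (λ fixes → let k , per = period-exists x in k , Equivalence.from (period∣⇔fixes per) fixes , per)
    (λ (k , k∣m , per) → Equivalence.to (period∣⇔fixes per) k∣m)

  distinct-shifts : Period x k → a < b → b < k → ¬ act a x ≈ act b x
  distinct-shifts {a = a} {b} (_ , below) a<b b<k eq =
    below (b ∸ a) (≤-<-trans (m∸n≤m b a) b<k) (m<n⇒0<n∸m a<b , fixes-∸ (<⇒≤ a<b) eq)

  period⇒orbit-count : Period x k → Count (Orbit x) k
  period⇒orbit-count {x} {k} per@((0<k , fixes) , _) = τ , (λ i → toℕ i , ≈-refl) , distinct , cover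
    where
    instance
      _ : NonZero k
      _ = >-nonZero 0<k
    τ : Fin k → Carrier
    τ i = act (toℕ i) x
    distinct : Distinct τ
    distinct i j i≢j with <-cmp (toℕ i) (toℕ j)
    ... | tri< i<j _ _ = distinct-shifts per i<j (toℕ<n j)
    ... | tri≈ _ i≡j _ = ⊥-elim (i≢j (toℕ-injective i≡j))
    ... | tri> _ _ j<i = distinct-shifts per j<i (toℕ<n i) ∘ sym
    cover : ∀ y → Orbit x y → ∃ λ i → τ i ≈ y
    cover y (j , e) = fromℕ< (m%n<n j k) , (begin
      act (toℕ (fromℕ< (m%n<n j k))) x ≡⟨ cong (λ t → act t x) (toℕ-fromℕ< (m%n<n j k)) ⟩
      act (j % k) x                    ≈⟨ act-% fixes j ⟨
      act j x                          ≈⟨ e ⟩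
      y                                ∎)

  orbit-count⇔period : Count (Orbit x) k ⇔ Period x k
  orbit-count⇔period {x} = mk⇔ (λ count → let p , per = period-exists x in
                                   subst (Period x) (count-unique (period⇒orbit-count per) count) per)
                               period⇒orbit-count

module CyclicShifts (n-1 : ℕ) where

  n : ℕ
  n = suc n-1

  σ^ : ℕ → Fin n → Fin n
  σ^ j = iter j (σ n)

  private variable
    j k : ℕ
    x : Fin n
    π π′ ρ ρ′ : Fun n

  [m+n%d]%d≡[m+n]%d : ∀ a b → (a + b % n) % n ≡ (a + b) % n
  [m+n%d]%d≡[m+n]%d a b = begin
    (a + b % n) % n           ≡⟨ %-distribˡ-+ a (b % n) n ⟩
    (a % n + b % n % n) % n   ≡⟨ cong (λ t → (a % n + t) % n) (m%n%n≡m%n b n) ⟩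
    (a % n + b % n) % n       ≡⟨ %-distribˡ-+ a b n ⟨
    (a + b) % n               ∎
    where open ≡-Reasoning

  toℕ-σ^ : ∀ j x → toℕ (σ^ j x) ≡ (toℕ x + j) % n
  toℕ-σ^ zero x = ≡-sym (≡-trans (cong (_% n) (+-identityʳ (toℕ x))) (m<n⇒m%n≡m (toℕ<n x)))
  toℕ-σ^ (suc j) x = begin
    toℕ (σ n (σ^ j x))          ≡⟨ toℕ-fromℕ< _ ⟩
    suc (toℕ (σ^ j x)) % n      ≡⟨ cong (λ t → suc t % n) (toℕ-σ^ j x) ⟩
    (1 + (toℕ x + j) % n) % n   ≡⟨ [m+n%d]%d≡[m+n]%d 1 (toℕ x + j) ⟩
    suc (toℕ x + j) % n         ≡⟨ cong (_% n) (+-suc (toℕ x) j) ⟨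
    (toℕ x + suc j) % n         ∎
    where open ≡-Reasoning

  σ^-mod : ∀ j x → σ^ j x ≡ (toℕ x + j) mod n
  σ^-mod j x = toℕ-injective (≡-trans (toℕ-σ^ j x) (≡-sym (toℕ-fromℕ< _)))

  σ^-+ : ∀ a b x → σ^ (a + b) x ≡ σ^ a (σ^ b x)
  σ^-+ zero b x = refl
  σ^-+ (suc a) b x = cong (σ n) (σ^-+ a b x)

  σ^-cong-% : j % n ≡ k % n → σ^ j x ≡ σ^ k x
  σ^-cong-% {j} {k} {x} j≡k = toℕ-injective (begin
    toℕ (σ^ j x)         ≡⟨ toℕ-σ^ j x ⟩
    (toℕ x + j) % n      ≡⟨ [m+n%d]%d≡[m+n]%d (toℕ x) j ⟨
    (toℕ x + j % n) % n  ≡⟨ cong (λ t → (toℕ x + t) % n) j≡k ⟩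
    (toℕ x + k % n) % n  ≡⟨ [m+n%d]%d≡[m+n]%d (toℕ x) k ⟩
    (toℕ x + k) % n      ≡⟨ toℕ-σ^ k x ⟨
    toℕ (σ^ k x)         ∎)
    where open ≡-Reasoning

  σ^-% : ∀ j x → σ^ (j % n) x ≡ σ^ j x
  σ^-% j x = σ^-cong-% {j % n} {j} (m%n%n≡m%n j n)

  σ^-*n : ∀ q x → σ^ (q * n) x ≡ x
  σ^-*n q x = σ^-cong-% {q * n} {0} (m*n%n≡0 q n)

  σ^-comm : ∀ a b x → σ^ a (σ^ b x) ≡ σ^ b (σ^ a x)
  σ^-comm a b x = ≡-trans (≡-sym (σ^-+ a b x)) (≡-trans (cong (λ t → σ^ t x) (+-comm a b)) (σ^-+ b a x))

  σ^-inverseˡ : ∀ j x → σ^ j (σ^ (j * n-1) x) ≡ x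
  σ^-inverseˡ j x = ≡-trans (≡-sym (σ^-+ j (j * n-1) x))
                      (≡-trans (cong (λ t → σ^ t x) (≡-sym (*-suc j n-1))) (σ^-*n j x))

  σ^-inverseʳ : ∀ j x → σ^ (j * n-1) (σ^ j x) ≡ x
  σ^-inverseʳ j x = ≡-trans (σ^-comm (j * n-1) j x) (σ^-inverseˡ j x)

  σ^-bijective : ∀ j → IsPerm n (σ^ j)
  σ^-bijective j =
    Bijection.bijective (Inverse⇒Bijection (mk↔ₛ′ (σ^ j) (σ^ (j * n-1)) (σ^-inverseˡ j) (σ^-inverseʳ j)))

  σ^⇒sameClass : ∀ j → (∀ x → π′ x ≡ σ^ j (π x)) → SameClass n π π′
  σ^⇒sameClass j eq = j % n , m%n<n j n , λ x → ≡-trans (eq x) (≡-sym (σ^-% j _))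

  ≗⇒sameClass : π ≗ π′ → SameClass n π π′
  ≗⇒sameClass π≗π′ = σ^⇒sameClass 0 (≡-sym ∘ π≗π′)

  sameClass-isEquivalence : IsEquivalence (SameClass n)
  sameClass-isEquivalence = record
    { refl  = ≗⇒sameClass λ _ → refl
    ; sym   = λ { {π} (j , _ , eq) → σ^⇒sameClass (j * n-1) λ x →
                    ≡-sym (≡-trans (cong (σ^ (j * n-1)) (eq x)) (σ^-inverseʳ j (π x))) }
    ; trans = λ { {π} (i , _ , eq) (j , _ , eq′) → σ^⇒sameClass (j + i) λ x →
                    ≡-trans (eq′ x) (≡-trans (cong (σ^ j) (eq x)) (≡-sym (σ^-+ j i (π x)))) }
    }

  open IsEquivalence sameClass-isEquivalence using () renaming (refl to ≈-refl; sym to ≈-sym)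

  sameClass? : Decidable (SameClass n)
  sameClass? π π′ = map′
    (λ (j , eq) → toℕ j , toℕ<n j , eq)
    (λ (j , j<n , eq) → fromℕ< j<n , λ x → ≡-trans (eq x) (cong (λ t → σ^ t (π x)) (≡-sym (toℕ-fromℕ< j<n))))
    (any? λ j → all? λ x → π′ x ≟ᶠ σ^ (toℕ j) (π x))

  classSetoid : Setoid 0ℓ 0ℓ
  classSetoid = record { Carrier = Fun n ; _≈_ = SameClass n ; isEquivalence = sameClass-isEquivalence }

  -- f(inc π) = inc (π ∘ σ), so f^j acts on representatives by precomposition with σ^j
  shift : ℕ → Fun n → Fun n
  shift j π = π ∘ σ^ j

  shift-cong : ∀ m {π π′} → SameClass n π π′ → SameClass n (shift m π) (shift m π′)
  shift-cong m (j , j<n , eq) = j , j<n , eq ∘ σ^ m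

  shift-0 : ∀ π → SameClass n (shift 0 π) π
  shift-0 π = ≈-refl

  shift-+ : ∀ a b π → SameClass n (shift (a + b) π) (shift b (shift a π))
  shift-+ a b π = ≗⇒sameClass (cong π ∘ σ^-+ a b)

  shift-n : ∀ π → SameClass n (shift n π) π
  shift-n π = ≗⇒sameClass λ x → cong π (σ^-cong-% {n} {0} {x} (n%n≡0 n))

  open Counting classSetoid public
  open FiniteOrderAction classSetoid sameClass? shift shift-cong shift-0 shift-+ n-1 shift-n public

  sameClass-perm : SameClass n π π′ → IsPerm n π → IsPerm n π′
  sameClass-perm (j , _ , eq) perm = ≗-bijective (≡-sym ∘ eq) (bijective _≡_ _≡_ _≡_ perm (σ^-bijective j))

  shift-perm : ∀ j → IsPerm n π → IsPerm n (shift j π)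
  shift-perm j perm = bijective _≡_ _≡_ _≡_ (σ^-bijective j) perm

  orbit-perm : IsPerm n ρ → Orbit ρ π → IsPerm n π
  orbit-perm perm (j , same) = sameClass-perm same (shift-perm j perm)

  orbitSize⇔count : IsPerm n ρ → OrbitSize n ρ k ⇔ Count (Orbit ρ) k
  orbitSize⇔count perm = mk⇔
    (λ (τ , mem , distinct , cover) → τ , proj₂ ∘ mem , distinct , λ π o → cover π (orbit-perm perm o) o)
    (λ (τ , mem , distinct , cover) → τ , (λ i → orbit-perm perm (mem i) , mem i) , distinct , λ π _ → cover π)

  eProp⇔fixes : ∀ d π → EProp n d π ⇔ Fixes π d
  eProp⇔fixes d π = mk⇔
    (λ (k , k<n , eq) → ≈-sym (k , k<n , λ x →
      ≡-trans (cong π (σ^-mod d x)) (≡-trans (eq x) (≡-sym (σ^-mod k (π x))))))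
    (λ fixes → let k , k<n , eq = ≈-sym fixes in k , k<n , λ x →
      ≡-trans (cong π (≡-sym (σ^-mod d x))) (≡-trans (eq x) (σ^-mod k (π x))))

  inE⇔fixes : ∀ {d} → IsPerm n π → InE n d π ⇔ Fixes π d
  inE⇔fixes {π} {d} perm = mk⇔
    (λ (π₀ , _ , eProp , same) →
      fixes-orbit {π₀} {π} {d} (≈⇒orbit same) (Equivalence.to (eProp⇔fixes d π₀) eProp))
    (λ fixes → π , perm , Equivalence.from (eProp⇔fixes d π) fixes , ≈-refl)

  orbits-meet⇒sameCycle : ∀ {ρ ρ′ π} → Orbit ρ π → Orbit ρ′ π → SameCycle n ρ ρ′
  orbits-meet⇒sameCycle {ρ} {ρ′} {π} o o′ π′ _ =
    mk⇔ (orbit-trans {ρ′} {ρ} {π′} (orbit-trans {ρ′} {π} {ρ} o′ (orbit-sym {ρ} {π} o)))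
        (orbit-trans {ρ} {ρ′} {π′} (orbit-trans {ρ} {π} {ρ′} o (orbit-sym {ρ′} {π} o′)))

  InCycleOfSize : ℕ → Pred (Fun n) 0ℓ
  InCycleOfSize k π = ∃ λ ρ → IsPerm n ρ × OrbitSize n ρ k × InOrbit n ρ π

  inCycle⇔period : IsPerm n π → InCycleOfSize k π ⇔ Period π k
  inCycle⇔period {π} perm = mk⇔
    (λ (ρ , permρ , size , o) → period-orbit {ρ} {π} o
      (Equivalence.to (orbit-count⇔period {ρ}) (Equivalence.to (orbitSize⇔count permρ) size)))
    (λ per → π , perm , Equivalence.from (orbitSize⇔count perm) (period⇒orbit-count per) , orbit-refl)

  inE⇔period∣ : ∀ d π → IsPerm n π → InE n d π ⇔ (∃ λ k → k ∣ d × Period π k)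
  inE⇔period∣ d π perm = mk⇔
    (Equivalence.to (fixes⇔period∣ {π} {d}) ∘ Equivalence.to (inE⇔fixes {π} {d} perm))
    (Equivalence.from (inE⇔fixes {π} {d} perm) ∘ Equivalence.from (fixes⇔period∣ {π} {d}))

  inE⇔inCycle : ∀ d π → IsPerm n π → InE n d π ⇔ (∃ λ k → k ∣ d × InCycleOfSize k π)
  inE⇔inCycle d π perm =
    mk⇔ (inCycle ∘ Equivalence.to (inE⇔period∣ d π perm)) (Equivalence.from (inE⇔period∣ d π perm) ∘ period)
    where
    inCycle : (∃ λ k → k ∣ d × Period π k) → ∃ λ k → k ∣ d × InCycleOfSize k π
    inCycle (k , k∣d , per) = k , k∣d , Equivalence.from (inCycle⇔period {π} {k} perm) per
    period : (∃ λ k → k ∣ d × InCycleOfSize k π) → ∃ λ k → k ∣ d × Period π k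
    period (k , k∣d , cyc) = k , k∣d , Equivalence.to (inCycle⇔period {π} {k} perm) cyc

  PermOfPeriod : ℕ → Pred (Fun n) 0ℓ
  PermOfPeriod k π = IsPerm n π × Period π k

  permOfPeriod-disjoint : Disjoint PermOfPeriod
  permOfPeriod-disjoint {j} {k} {π} {π′} (_ , perᵢ) (_ , perⱼ) same =
    period-unique perᵢ (period-orbit {π′} {π} {k} (orbit-sym {π} {π′} (≈⇒orbit same)) perⱼ)

  numCycles⇒count-permOfPeriod : ∀ {c} → NumCycles n k c → Count (PermOfPeriod k) (c * k)
  numCycles⇒count-permOfPeriod {k} (τ , mem , distinct , cover) =
    count-⇔ (λ π → mk⇔ to from) (count-⋃ count-orbit disjoint)
    where
    count-orbit : ∀ i → Count (Orbit (τ i)) k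
    count-orbit i = Equivalence.to (orbitSize⇔count (proj₁ (mem i))) (proj₂ (mem i))
    disjoint : Disjoint (λ i → Orbit (τ i))
    disjoint {i} {j} {π} {π′} o o′ same = decidable-stable (i ≟ᶠ j) λ i≢j → distinct i j i≢j
      (orbits-meet⇒sameCycle {τ i} {τ j} {π′} (orbit-trans {τ i} {π} {π′} o (≈⇒orbit same)) o′)
    to : ∀ {π} → (∃ λ i → Orbit (τ i) π) → PermOfPeriod k π
    to {π} (i , o) = orbit-perm (proj₁ (mem i)) o ,
      Equivalence.to (inCycle⇔period (orbit-perm (proj₁ (mem i)) o)) (τ i , proj₁ (mem i) , proj₂ (mem i) , o)
    from : ∀ {π} → PermOfPeriod k π → ∃ λ i → Orbit (τ i) π
    from {π} (perm , per) =
      let i , same = cover π perm (Equivalence.from (orbitSize⇔count perm) (period⇒orbit-count per))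
      in i , Equivalence.from (same π perm) orbit-refl

  cardE⇒count : ∀ {d e} → CardE n d e → Count (λ π → IsPerm n π × InE n d π) e
  cardE⇒count (τ , mem , distinct , cover) = τ , mem , distinct , λ π (perm , inE) → cover π perm inE

  period∣⇔inE : ∀ d .{{_ : NonZero d}} π →
                (∃ λ k → k < suc d × k ∣ d × PermOfPeriod k π) ⇔ (IsPerm n π × InE n d π)
  period∣⇔inE d π = mk⇔
    (λ (k , _ , k∣d , perm , per) → perm , Equivalence.from (inE⇔period∣ d π perm) (k , k∣d , per))
    (λ (perm , inE) → let k , k∣d , per = Equivalence.to (inE⇔period∣ d π perm) inE in
      k , s≤s (∣⇒≤ k∣d) , k∣d , perm , per)

  cardE≡properDivSum+d*c[d] : ∀ {d e} .{{_ : NonZero d}} (c : ℕ → ℕ) →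
                              CardE n d e → (∀ k → k ∣ d → NumCycles n k (c k)) →
                              e ≡ properDivSum d c + d * c d
  cardE≡properDivSum+d*c[d] {d} {e} c card cycles = begin
    e                                                         ≡⟨ count-unique (cardE⇒count card) count-E ⟩
    sum (map g (filter (_∣? d) (upTo (suc d))))               ≡⟨ sum-filter-upTo-suc (_∣? d) g d ⟩
    properDivSum d c + sum (map g (filter (_∣? d) (d ∷ []))) ≡⟨ cong (λ t → properDivSum d c + t) d-term ⟩
    properDivSum d c + d * c d                                ∎
    where
    open ≡-Reasoning
    g : ℕ → ℕ
    g k = k * c k
    d-term : sum (map g (filter (_∣? d) (d ∷ []))) ≡ d * c d
    d-term = sum-filter-singleton (_∣? d) g ∣-refl
    count-period : ∀ k → k ∣ d → Count (PermOfPeriod k) (g k)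
    count-period k k∣d =
      subst (Count (PermOfPeriod k)) (*-comm (c k) k) (numCycles⇒count-permOfPeriod (cycles k k∣d))
    count-E : Count (λ π → IsPerm n π × InE n d π) (sum (map g (filter (_∣? d) (upTo (suc d)))))
    count-E = count-⇔ (period∣⇔inE d) (count-⋃-upTo (_∣? d) count-period permOfPeriod-disjoint (suc d))

proposition8 : (n d : ℕ) → {{_ : NonZero n}} → {{_ : NonZero d}} →
    (∀ π → IsPerm n π →
    (InE n d π ⇔ (∃[ k ] (k ∣ d × ∃[ ρ ] (IsPerm n ρ × OrbitSize n ρ k × InOrbit n ρ π)))))
    × (∀ (e : ℕ) (c : ℕ → ℕ) → CardE n d e → (∀ k → k ∣ d → NumCycles n k (c k)) →
    (+ c d) / 1 ≡ ((+ e) - (+ properDivSum d c)) / d)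
proposition8 zero _ {{()}}
proposition8 (suc n-1) d =
  inE⇔inCycle d , λ _ c card cycles → e≡s+n*m⇒m/1≡[e-s]/n (cardE≡properDivSum+d*c[d] c card cycles)
  where open CyclicShifts n-1
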